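{- Let $(G,\ast)$ be a finite group and let $\mathcal{H}$ be a periodic partition of $(G,\ast)$. Then there exists a normal subgroup $N$ of $G$ such that $\mathcal{H}$ is the quotient group $G/N$, i.e., $\mathcal{H}$ is the set of cosets of $N$ in $G$.
   Context: For $A,B\subset G$, $A\ast B=\{a\ast b:a\in A,b\in B\}$. For a set $\mathcal{H}$ of subsets, $\mathcal{H}^{\ast}=\{A\ast B:A,B\in\mathcal{H}\}$, $\mathcal{H}^{0\ast}=\mathcal{H}$, $\mathcal{H}^{n\ast}=(\mathcal{H}^{(n-1)\ast})^{\ast}$. A partition $\mathcal{H}$ of $G$ is periodic if $\mathcal{H}^{n\ast}=\mathcal{H}$ for some $n>0$. -}

module Defs where

open import Level using (Level; _⊔_; suc)
open import Algebra.Bundles using (Group)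
open import Data.Nat using (ℕ; zero) renaming (suc to sucℕ)
open import Data.Fin using (Fin)
open import Data.Product using (Σ; ∃; _×_; _,_)
open import Relation.Binary.PropositionalEquality using (_≡_)
import Relation.Binary.PropositionalEquality as P
open import Function.Bundles using (Inverse)

module _ {c ℓ : Level} (G : Group c ℓ) where
  open Group G

  Finite : Set (c ⊔ ℓ)
  Finite = Σ ℕ λ n → Inverse (P.setoid (Fin n)) setoid

  record Subset : Set (suc (c ⊔ ℓ)) where
    field
      mem  : Carrier → Set (c ⊔ ℓ)
      resp : ∀ {x y} → x ≈ y → mem x → mem y
  open Subset public

  _≐_ : Subset → Subset → Set (c ⊔ ℓ)
  A ≐ B = (∀ x → mem A x → mem B x) × (∀ x → mem B x → mem A x)

  _⊛_ : Subset → Subset → Subset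
  mem (A ⊛ B) x = Σ Carrier λ a → Σ Carrier λ b → mem A a × mem B b × x ≈ a ∙ b
  resp (A ⊛ B) x≈y (a , b , a∈A , b∈B , x≈ab) = a , b , a∈A , b∈B , trans (sym x≈y) x≈ab

  -- A set of subsets, given as an indexed family I → Subset.
  record Family : Set (suc (c ⊔ ℓ)) where
    constructor fam
    field
      Idx : Set c
      blk : Idx → Subset
  open Family public

  -- Equality of the *sets* of subsets represented by two families.
  _≋_ : Family → Family → Set (c ⊔ ℓ)
  F ≋ H = (∀ i → Σ (Idx H) λ j → blk F i ≐ blk H j)
        × (∀ j → Σ (Idx F) λ i → blk F i ≐ blk H j)

  _^⊛ : Family → Family
  F ^⊛ = fam (Idx F × Idx F) λ { (i , j) → blk F i ⊛ blk F j }

  iter⊛ : ℕ → Family → Family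
  iter⊛ zero F = F
  iter⊛ (sucℕ n) F = (iter⊛ n F) ^⊛

  -- A partition of G: nonempty blocks, every element in some block,
  -- and blocks with distinct indices are disjoint (so no block repeats).
  record IsPartition (F : Family) : Set (c ⊔ ℓ) where
    field
      nonempty : ∀ i → Σ Carrier λ x → mem (blk F i) x
      cover    : ∀ x → Σ (Idx F) λ i → mem (blk F i) x
      disjoint : ∀ i j x → mem (blk F i) x → mem (blk F j) x → i ≡ j

  Periodic : Family → Set (c ⊔ ℓ)
  Periodic F = Σ ℕ λ n → iter⊛ (sucℕ n) F ≋ F

  record IsNormalSubgroup (N : Subset) : Set (c ⊔ ℓ) where
    field
      ε∈   : mem N ε
      ∙∈   : ∀ {x y} → mem N x → mem N y → mem N (x ∙ y)
      ⁻¹∈  : ∀ {x} → mem N x → mem N (x ⁻¹)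
      conj : ∀ g {x} → mem N x → mem N (g ∙ x ∙ g ⁻¹)

  coset : Subset → Carrier → Subset
  mem (coset N g) x = Σ Carrier λ n → mem N n × x ≈ g ∙ n
  resp (coset N g) x≈y (n , n∈N , x≈gn) = n , n∈N , trans (sym x≈y) x≈gn

  Cosets : Subset → Family
  Cosets N = fam Carrier (coset N)

-- Periodicity forces each product of two blocks into a single block: iterating
-- ∗ from 𝓗 and always multiplying by a block that contains ε keeps A ∗ B inside
-- one member of 𝓗^{(n+1)∗} = 𝓗. Disjointness of blocks then says that the block
-- of a product depends only on the blocks of the factors, so the block N of ε is
-- a normal subgroup and the block of a is a N.
module Submission where

open import Level using (Level; _⊔_)
open import Algebra.Bundles using (Group)
import Algebra.Properties.Group as GroupProperties
open import Data.Nat using (zero; suc)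
open import Data.Product using (Σ; _×_; _,_; proj₁; proj₂)
open import Relation.Binary.PropositionalEquality using (_≡_; subst)

open import Defs

module _ {c ℓ : Level} (G : Group c ℓ) where
  open Group G
  open GroupProperties G using (\\-leftDividesˡ)

  private
    infixl 7 _∗_
    _∗_ : Subset G → Subset G → Subset G
    _∗_ = _⊛_ G

  infix 4 _⊆_
  _⊆_ : Subset G → Subset G → Set (c ⊔ ℓ)
  A ⊆ B = ∀ x → mem A x → mem B x

  ∙-∈-⊛ : ∀ A B {a b} → mem A a → mem B b → mem (A ∗ B) (a ∙ b)
  ∙-∈-⊛ _ _ {a} {b} a∈A b∈B = a , b , a∈A , b∈B , refl

  ⊆-⊛-unitʳ : ∀ A T → mem T ε → A ⊆ A ∗ T
  ⊆-⊛-unitʳ _ _ ε∈T x x∈A = x , ε , x∈A , ε∈T , sym (identityʳ x)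

  ProductClosed : Family G → Set (c ⊔ ℓ)
  ProductClosed F = ∀ i k → Σ (Idx F) λ j → blk F i ∗ blk F k ⊆ blk F j

  module _ (F : Family G) {e : Idx F} (ε∈e : mem (blk F e) ε) where

    unitIdx : ∀ m → Idx (iter⊛ G m F)
    unitIdx zero    = e
    unitIdx (suc m) = unitIdx m , unitIdx m

    ε∈unitIdx : ∀ m → mem (blk (iter⊛ G m F) (unitIdx m)) ε
    ε∈unitIdx zero    = ε∈e
    ε∈unitIdx (suc m) = ε , ε , ε∈unitIdx m , ε∈unitIdx m , sym (identityˡ ε)

    ⊛-⊆-iter⊛ : ∀ i k m → Σ (Idx (iter⊛ G (suc m) F)) λ t →
                blk F i ∗ blk F k ⊆ blk (iter⊛ G (suc m) F) t
    ⊛-⊆-iter⊛ i k zero = (i , k) , λ _ x∈ik → x∈ik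
    ⊛-⊆-iter⊛ i k (suc m) with ⊛-⊆-iter⊛ i k m
    ... | t , ik⊆t = (t , unitIdx (suc m)) , λ x x∈ik → t⊆tu x (ik⊆t x x∈ik)
      where
      t⊆tu : blk (iter⊛ G (suc m) F) t ⊆ blk (iter⊛ G (suc (suc m)) F) (t , unitIdx (suc m))
      t⊆tu = ⊆-⊛-unitʳ (blk (iter⊛ G (suc m) F) t)
                       (blk (iter⊛ G (suc m) F) (unitIdx (suc m))) (ε∈unitIdx (suc m))

    periodic⇒productClosed : Periodic G F → ProductClosed F
    periodic⇒productClosed (n , iter⊛F≋F) i k with ⊛-⊆-iter⊛ i k n
    ... | t , ik⊆t with proj₁ iter⊛F≋F t
    ... | j , t⊆j , _ = j , λ x x∈ik → t⊆j x (ik⊆t x x∈ik)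

  module _ (H : Family G) (partition : IsPartition G H) (closed : ProductClosed H) where
    open IsPartition partition

    private
      _∈_ : Carrier → Idx H → Set (c ⊔ ℓ)
      x ∈ i = mem (blk H i) x

    block : Carrier → Idx H
    block x = proj₁ (cover x)

    ∈-block : ∀ x → x ∈ block x
    ∈-block x = proj₂ (cover x)

    unitBlock : Subset G
    unitBlock = blk H (block ε)

    ε∈unitBlock : mem unitBlock ε
    ε∈unitBlock = ∈-block ε

    ⊛-⊆-block : ∀ {i k j x y} → x ∈ i → y ∈ k → (x ∙ y) ∈ j →
                blk H i ∗ blk H k ⊆ blk H j
    ⊛-⊆-block {i} {k} {j} {x} {y} x∈i y∈k xy∈j with closed i k
    ... | j′ , ik⊆j′ = subst (λ l → blk H i ∗ blk H k ⊆ blk H l) j′≡j ik⊆j′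
      where
      j′≡j : j′ ≡ j
      j′≡j = disjoint j′ j (x ∙ y) (ik⊆j′ (x ∙ y) (∙-∈-⊛ (blk H i) (blk H k) x∈i y∈k)) xy∈j

    ∙-unitBlock-∈ : ∀ {i a n} → a ∈ i → mem unitBlock n → (a ∙ n) ∈ i
    ∙-unitBlock-∈ {i} {a} {n} a∈i n∈N =
      ⊛-⊆-block a∈i ε∈unitBlock (resp (blk H i) (sym (identityʳ a)) a∈i) (a ∙ n)
        (∙-∈-⊛ (blk H i) unitBlock a∈i n∈N)

    ∙-∈-unitBlock : ∀ {i k x y a b} → x ∈ i → y ∈ k → x ∙ y ≈ ε →
                    a ∈ i → b ∈ k → mem unitBlock (a ∙ b)
    ∙-∈-unitBlock {i} {k} {a = a} {b} x∈i y∈k xy≈ε a∈i b∈k =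
      ⊛-⊆-block x∈i y∈k (resp unitBlock (sym xy≈ε) ε∈unitBlock) (a ∙ b)
        (∙-∈-⊛ (blk H i) (blk H k) a∈i b∈k)

    unitBlock-normal : IsNormalSubgroup G unitBlock
    unitBlock-normal = record
      { ε∈   = ε∈unitBlock
      ; ∙∈   = ∙-unitBlock-∈
      ; ⁻¹∈  = λ {x} x∈N → resp unitBlock (identityʳ (x ⁻¹))
                 (∙-∈-unitBlock (∈-block (x ⁻¹)) x∈N (inverseˡ x) (∈-block (x ⁻¹)) ε∈unitBlock)
      ; conj = λ g x∈N → ∙-∈-unitBlock (∈-block g) (∈-block (g ⁻¹)) (inverseʳ g)
                 (∙-unitBlock-∈ (∈-block g) x∈N) (∈-block (g ⁻¹))
      }

    block≐coset : ∀ {i a} → a ∈ i → _≐_ G (blk H i) (coset G unitBlock a)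
    block≐coset {i} {a} a∈i = block⊆coset , coset⊆block
      where
      block⊆coset : ∀ y → y ∈ i → mem (coset G unitBlock a) y
      block⊆coset y y∈i =
        a ⁻¹ ∙ y ,
        ∙-∈-unitBlock (∈-block (a ⁻¹)) a∈i (inverseˡ a) (∈-block (a ⁻¹)) y∈i ,
        sym (\\-leftDividesˡ a y)

      coset⊆block : ∀ y → mem (coset G unitBlock a) y → y ∈ i
      coset⊆block y (n , n∈N , y≈an) = resp (blk H i) (sym y≈an) (∙-unitBlock-∈ a∈i n∈N)

    ≋-cosets : _≋_ G H (Cosets G unitBlock)
    ≋-cosets = (λ i → let a , a∈i = nonempty i in a , block≐coset a∈i)
             , (λ g → block g , block≐coset (∈-block g))

mainTheorem10 : ∀ {c ℓ : Level} (G : Group c ℓ) → Finite G →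
    (H : Family G) → IsPartition G H → Periodic G H →
    Σ (Subset G) λ N → IsNormalSubgroup G N × _≋_ G H (Cosets G N)
mainTheorem10 G _ H partition periodic =
  unitBlock G H partition closed ,
  unitBlock-normal G H partition closed ,
  ≋-cosets G H partition closed
  where
  closed : ProductClosed G H
  closed = periodic⇒productClosed G H (proj₂ (IsPartition.cover partition (Group.ε G))) periodic
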